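{- Let $m_1$ and $m_2$ be positive integers with $\frac{3}{2}m_1\le m_2<2m_1$. Then $R_{m_2}\le 4R_{m_1}$.
   Context: For a positive integer $m$, let $\mathbb{Z}_m=\mathbb{Z}/m\mathbb{Z}$. For $A\subseteq \mathbb{Z}_m$ and $n\in\mathbb{Z}_m$, let $\sigma_A(n)$ denote the number of ordered pairs $(x,y)\in A\times A$ with $x+y=n$ in $\mathbb{Z}_m$. The Ruzsa number $R_m$ is the least positive integer $r$ such that there exists a set $A\subseteq\mathbb{Z}_m$ with $1\le \sigma_A(n)\le r$ for all $n\in\mathbb{Z}_m$. -}

module Defs where

open import Data.Nat using (ℕ; zero; suc; _+_; _*_; _≤_; _<_; NonZero)
open import Data.Nat.DivMod using (_%_)
open import Data.Fin using (Fin; toℕ)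
open import Data.Fin.Subset using (Subset; _∈_)
open import Data.Fin.Subset.Properties using (_∈?_)
open import Data.List using (List; allFin; cartesianProduct; filter; length)
open import Data.Product using (_×_; _,_; Σ; ∃-syntax)
open import Relation.Nullary using (Dec; yes; no; ¬_)
open import Relation.Nullary.Decidable using (_×-dec_)
open import Relation.Binary.PropositionalEquality using (_≡_)
import Data.Nat as ℕ

-- Addition in ℤ_m, with ℤ_m represented by Fin m (residues 0..m-1),
-- compared via natural-number representatives: x + y ≡ n in ℤ_m
-- iff (toℕ x + toℕ y) % m ≡ toℕ n.
SumIs : (m : ℕ) .{{_ : NonZero m}} → Fin m → Fin m → Fin m → Set
SumIs m x y n = (toℕ x + toℕ y) % m ≡ toℕ n

σ : (m : ℕ) .{{_ : NonZero m}} → Subset m → Fin m → ℕ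
σ m A n = length (filter (λ p → dec p) (cartesianProduct (allFin m) (allFin m)))
  where
  dec : (p : Fin m × Fin m) → Dec ((Data.Product.proj₁ p ∈ A × Data.Product.proj₂ p ∈ A) × SumIs m (Data.Product.proj₁ p) (Data.Product.proj₂ p) n)
  dec (x , y) = ((x ∈? A) ×-dec (y ∈? A)) ×-dec ((toℕ x + toℕ y) % m ℕ.≟ toℕ n)

Admissible : (m : ℕ) .{{_ : NonZero m}} → Subset m → ℕ → Set
Admissible m A r = (n : Fin m) → 1 ≤ σ m A n × σ m A n ≤ r

IsRuzsaNumber : (m : ℕ) .{{_ : NonZero m}} → ℕ → Set
IsRuzsaNumber m r =
  1 ≤ r × (∃[ A ] Admissible m A r) ×
  ((r' : ℕ) → 1 ≤ r' → ∃[ A ] Admissible m A r' → r ≤ r')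

{-# OPTIONS --safe #-}
-- Given A ⊆ ℤ_{m₁} with 1 ≤ σ_A ≤ r, let B ⊆ ℤ_{m₂} consist of the residues mod m₂
-- of a and a + m₁ (a ∈ A). Every t ∈ ℤ_{m₂} has a representative s ∈ [m₁, 3m₁);
-- writing s ≡ a + b (mod m₁) with a, b ∈ A gives s = (a + e₁m₁) + (b + e₂m₁) with
-- e₁, e₂ ∈ {0, 1}, so σ_B(t) ≥ 1. Conversely a solution of x + y = t in B lifts to
-- (a + e₁m₁) + (b + e₂m₁) = t + km₂, which is determined by (e₁, k, a, b) and has
-- a + b ≡ t + km₂ (mod m₁). As 3m₁ ≤ 2m₂, for fixed t at most four pairs (e₁, k)
-- occur, whence σ_B(t) ≤ 4r.
module Submission where

open import Defs
open import Data.Fin using (Fin; zero; suc; toℕ)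
open import Data.Fin.Properties using (any?; toℕ<n; toℕ-fromℕ<; toℕ-injective)
open import Data.Fin.Subset using (Subset) renaming (_∈_ to _∈ₛ_)
open import Data.Fin.Subset.Properties using (_∈?_)
open import Data.List using (List; []; _∷_; _++_; allFin; cartesianProduct; concatMap; filter; length; map)
open import Data.List.Membership.Propositional using (_∈_; lose)
open import Data.List.Membership.Propositional.Properties
  using ( ∈-∃++; ∈-length; ∈-++⁻; ∈-++⁺ˡ; ∈-++⁺ʳ; ∈-allFin; ∈-cartesianProduct⁺; ∈-concatMap⁺
        ; ∈-filter⁺; ∈-filter⁻; ∈-map⁺)
open import Data.List.Properties using (length-++; length-map)
open import Data.List.Relation.Unary.All using (lookup)
open import Data.List.Relation.Unary.AllPairs using (_∷_)
open import Data.List.Relation.Unary.Any using (here; there)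
open import Data.List.Relation.Unary.Unique.Propositional using (Unique)
import Data.List.Relation.Unary.Unique.Propositional.Properties as Unique
open import Data.Nat using (ℕ; zero; suc; _+_; _*_; _∸_; _≤_; _<_; z≤n; s≤s; NonZero; _≟_; _<?_)
open import Data.Nat.DivMod
open import Data.Nat.Properties
open import Data.Nat.Tactic.RingSolver using (solve-∀)
open import Data.Product using (_×_; _,_; proj₁; proj₂; ∃-syntax; Σ-syntax)
open import Data.Sum using (inj₁; inj₂)
open import Data.Vec using (tabulate)
open import Data.Vec.Properties using (lookup∘tabulate; []=⇒lookup; lookup⇒[]=)
open import Function using (_∘_)
open import Relation.Binary.PropositionalEquality
open import Relation.Nullary using (Dec; yes; no; does; contradiction)
open import Relation.Nullary.Decidable using (_×-dec_; dec-true)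

injective-encoding⇒length≤ : {X Y : Set} {R : X → Y → Set} {xs : List X} (ys : List Y) →
  Unique xs → (∀ {x} → x ∈ xs → ∃[ y ] y ∈ ys × R x y) →
  (∀ {x x′ y} → R x y → R x′ y → x ≡ x′) → length xs ≤ length ys
injective-encoding⇒length≤ {xs = []} ys _ _ _ = z≤n
injective-encoding⇒length≤ {R = R} {xs = x ∷ xs} ys (x∉xs ∷ xs!) encode injective
  with encode (here refl)
... | y , y∈ys , Rxy with ∈-∃++ y∈ys
... | ys₁ , ys₂ , refl = begin
  suc (length xs)              ≤⟨ s≤s (injective-encoding⇒length≤ (ys₁ ++ ys₂) xs! encode′ injective) ⟩
  suc (length (ys₁ ++ ys₂))    ≡⟨ cong suc (length-++ ys₁) ⟩
  suc (length ys₁ + length ys₂) ≡⟨ +-suc (length ys₁) (length ys₂) ⟨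
  length ys₁ + length (y ∷ ys₂) ≡⟨ length-++ ys₁ ⟨
  length (ys₁ ++ y ∷ ys₂)      ∎
  where
  open ≤-Reasoning
  encode′ : ∀ {x′} → x′ ∈ xs → ∃[ y′ ] y′ ∈ ys₁ ++ ys₂ × R x′ y′
  encode′ x′∈xs with encode (there x′∈xs)
  ... | y′ , y′∈ys , Rx′y′ with ∈-++⁻ ys₁ y′∈ys
  ...   | inj₁ y′∈ys₁        = y′ , ∈-++⁺ˡ y′∈ys₁ , Rx′y′
  ...   | inj₂ (there y′∈ys₂) = y′ , ∈-++⁺ʳ ys₁ y′∈ys₂ , Rx′y′
  ...   | inj₂ (here refl)    = contradiction (injective Rxy Rx′y′) (lookup x∉xs x′∈xs)

length-concatMap≤ : {X Y : Set} (f : X → List Y) {r : ℕ} → (∀ x → length (f x) ≤ r) →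
  (xs : List X) → length (concatMap f xs) ≤ length xs * r
length-concatMap≤ f bound []       = z≤n
length-concatMap≤ f bound (x ∷ xs) = begin
  length (f x ++ concatMap f xs)         ≡⟨ length-++ (f x) ⟩
  length (f x) + length (concatMap f xs) ≤⟨ +-mono-≤ (bound x) (length-concatMap≤ f bound xs) ⟩
  _ + length xs * _                       ∎
  where open ≤-Reasoning

-- counted? repeats the decision procedure inside σ, so σ m A n is length (pairs A n) by definition.
module _ {m : ℕ} .{{_ : NonZero m}} (A : Subset m) (n : Fin m) where

  private
    counted? : (p : Fin m × Fin m) →
               Dec ((proj₁ p ∈ₛ A × proj₂ p ∈ₛ A) × SumIs m (proj₁ p) (proj₂ p) n)
    counted? (x , y) = ((x ∈? A) ×-dec (y ∈? A)) ×-dec ((toℕ x + toℕ y) % m ≟ toℕ n)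

  pairs : List (Fin m × Fin m)
  pairs = filter counted? (cartesianProduct (allFin m) (allFin m))

  pairs-unique : Unique pairs
  pairs-unique = Unique.filter⁺ counted? (Unique.cartesianProduct⁺ (Unique.allFin⁺ m) (Unique.allFin⁺ m))

  ∈-pairs⁺ : ∀ {x y} → x ∈ₛ A → y ∈ₛ A → SumIs m x y n → (x , y) ∈ pairs
  ∈-pairs⁺ x∈A y∈A x+y≡n =
    ∈-filter⁺ counted? (∈-cartesianProduct⁺ (∈-allFin _) (∈-allFin _)) ((x∈A , y∈A) , x+y≡n)

  ∈-pairs⁻ : ∀ {x y} → (x , y) ∈ pairs → (x ∈ₛ A × y ∈ₛ A) × SumIs m x y n
  ∈-pairs⁻ = proj₂ ∘ ∈-filter⁻ counted? {xs = cartesianProduct (allFin m) (allFin m)}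

member-of-nonempty : {X : Set} (xs : List X) → 0 < length xs → ∃[ x ] x ∈ xs
member-of-nonempty (x ∷ _) _ = x , here refl

SumIs-mod : ∀ {m} .{{_ : NonZero m}} {u v} {n : Fin m} → (u + v) % m ≡ toℕ n →
  SumIs m (u mod m) (v mod m) n
SumIs-mod {m} {u = u} {v} u+v≡n = begin
  (toℕ (u mod m) + toℕ (v mod m)) % m ≡⟨ cong₂ (λ x y → (x + y) % m) (toℕ-fromℕ< (m%n<n u m))
                                                                     (toℕ-fromℕ< (m%n<n v m)) ⟩
  (u % m + v % m) % m                 ≡⟨ %-distribˡ-+ u v m ⟨
  (u + v) % m                         ≡⟨ u+v≡n ⟩
  _                                   ∎
  where open ≡-Reasoning

u+v≡t+[u+v]/m*m : ∀ {m} .{{_ : NonZero m}} {u v x y t} →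
  u % m ≡ x → v % m ≡ y → (x + y) % m ≡ t → u + v ≡ t + (u + v) / m * m
u+v≡t+[u+v]/m*m {m} {u} {v} {x} {y} {t} u≡x v≡y x+y≡t = begin
  u + v                           ≡⟨ m≡m%n+[m/n]*n (u + v) m ⟩
  (u + v) % m + q * m             ≡⟨ cong (_+ q * m) (%-distribˡ-+ u v m) ⟩
  (u % m + v % m) % m + q * m     ≡⟨ cong₂ (λ x′ y′ → (x′ + y′) % m + q * m) u≡x v≡y ⟩
  (x + y) % m + q * m             ≡⟨ cong (_+ q * m) x+y≡t ⟩
  t + q * m                       ∎
  where
  open ≡-Reasoning
  q = (u + v) / m

[u%m≡s%m]⇒s≡u+[s/m∸u/m]*m : ∀ {u s m} .{{_ : NonZero m}} → u % m ≡ s % m → u / m ≤ s / m →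
  s ≡ u + (s / m ∸ u / m) * m
[u%m≡s%m]⇒s≡u+[s/m∸u/m]*m {u} {s} {m} u%m≡s%m u/m≤s/m = begin
  s                                  ≡⟨ m≡m%n+[m/n]*n s m ⟩
  s % m + s / m * m                  ≡⟨ cong₂ (λ r q → r + q * m) (sym u%m≡s%m)
                                                                   (sym (m+[n∸m]≡n u/m≤s/m)) ⟩
  u % m + (u / m + c) * m            ≡⟨ cong (u % m +_) (*-distribʳ-+ m (u / m) c) ⟩
  u % m + (u / m * m + c * m)        ≡⟨ +-assoc (u % m) (u / m * m) (c * m) ⟨
  u % m + u / m * m + c * m          ≡⟨ cong (_+ c * m) (m≡m%n+[m/n]*n u m) ⟨
  u + c * m                          ∎
  where
  open ≡-Reasoning
  c = s / m ∸ u / m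

sum-of-two-bits : ∀ {c} → c ≤ 2 → Σ[ e₁ ∈ Fin 2 ] Σ[ e₂ ∈ Fin 2 ] toℕ e₁ + toℕ e₂ ≡ c
sum-of-two-bits {0}                 _ = zero , zero , refl
sum-of-two-bits {1}                 _ = suc zero , zero , refl
sum-of-two-bits {2}                 _ = suc zero , suc zero , refl
sum-of-two-bits {suc (suc (suc _))} (s≤s (s≤s ()))

module Doubling (m₁ m₂ : ℕ) .{{_ : NonZero m₁}} .{{_ : NonZero m₂}}
                (3m₁≤2m₂ : 3 * m₁ ≤ 2 * m₂) (m₂<2m₁ : m₂ < 2 * m₁) where

  m₁≤m₂ : m₁ ≤ m₂
  m₁≤m₂ = *-cancelˡ-≤ 2 (≤-trans (m≤n+m (2 * m₁) m₁) 3m₁≤2m₂)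

  4m₁≤3m₂ : 4 * m₁ ≤ 3 * m₂
  4m₁≤3m₂ = +-mono-≤ m₁≤m₂ 3m₁≤2m₂

  lift : ℕ → Fin 2 → ℕ
  lift a e = a + toℕ e * m₁

  lift<2m₁ : ∀ {a} e → a < m₁ → lift a e < 2 * m₁
  lift<2m₁ {a} zero    a<m₁ = begin-strict
    a + 0  ≡⟨ +-identityʳ a ⟩
    a      <⟨ a<m₁ ⟩
    m₁     ≤⟨ m≤m+n m₁ (m₁ + 0) ⟩
    2 * m₁ ∎
    where open ≤-Reasoning
  lift<2m₁ (suc zero) a<m₁ = +-monoˡ-< (m₁ + 0) a<m₁

  lift-sum<4m₁ : ∀ {a b} e₁ e₂ → a < m₁ → b < m₁ → lift a e₁ + lift b e₂ < 4 * m₁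
  lift-sum<4m₁ e₁ e₂ a<m₁ b<m₁ =
    <-≤-trans (+-mono-< (lift<2m₁ e₁ a<m₁) (lift<2m₁ e₂ b<m₁))
              (≤-reflexive (sym (*-distribʳ-+ m₁ 2 2)))

  lift-sum≡ : ∀ a b e₁ e₂ → lift a e₁ + lift b e₂ ≡ a + b + (toℕ e₁ + toℕ e₂) * m₁
  lift-sum≡ a b e₁ e₂ = regroup a b (toℕ e₁) (toℕ e₂) m₁
    where
    regroup : ∀ a b x y m → a + x * m + (b + y * m) ≡ a + b + (x + y) * m
    regroup = solve-∀

  lift-sum%m₁ : ∀ a b e₁ e₂ → (a + b) % m₁ ≡ (lift a e₁ + lift b e₂) % m₁
  lift-sum%m₁ a b e₁ e₂ = trans (sym ([m+kn]%n≡m%n (a + b) (toℕ e₁ + toℕ e₂) m₁))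
                                (cong (_% m₁) (sym (lift-sum≡ a b e₁ e₂)))

  extraWrap : ℕ → ℕ
  extraWrap t with t + 2 * m₂ <? 4 * m₁
  ... | yes _ = 2
  ... | no  _ = 0

  extraWrap≡2 : ∀ {t} → t + 2 * m₂ < 4 * m₁ → extraWrap t ≡ 2
  extraWrap≡2 {t} lt with t + 2 * m₂ <? 4 * m₁
  ... | yes _  = refl
  ... | no ¬lt = contradiction lt ¬lt

  extraWrap≡0 : ∀ {t} → m₁ ≤ t → extraWrap t ≡ 0
  extraWrap≡0 {t} m₁≤t with t + 2 * m₂ <? 4 * m₁
  ... | yes lt = contradiction (+-mono-≤ m₁≤t 3m₁≤2m₂) (<⇒≱ lt)
  ... | no _   = refl

  -- The candidates (1 , 0) and (1 , 2) exclude each other: the first forces m₁ ≤ t,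
  -- the second t + 2m₂ < 4m₁.
  shifts : ℕ → List (Fin 2 × ℕ)
  shifts t = (zero , 0) ∷ (zero , 1) ∷ (suc zero , 1) ∷ (suc zero , extraWrap t) ∷ []

  wraps< : ∀ {t k j} → t + k * m₂ < j * m₂ → k < j
  wraps< {t} {k} {j} lt = *-cancelʳ-< m₂ k j (≤-<-trans (m≤n+m (k * m₂) t) lt)

  shift∈shifts : ∀ {a b t k} e₁ e₂ → a < m₁ → b < m₁ →
                 lift a e₁ + lift b e₂ ≡ t + k * m₂ → (e₁ , k) ∈ shifts t
  shift∈shifts {k = 0} zero _ _ _ _ = here refl
  shift∈shifts {k = 1} zero _ _ _ _ = there (here refl)
  shift∈shifts {a} {b} {t} {suc (suc k)} zero e₂ a<m₁ b<m₁ sum≡ =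
    contradiction (wraps< {t} (begin-strict
      t + (2 + k) * m₂        ≡⟨ sum≡ ⟨
      lift a zero + lift b e₂ <⟨ +-mono-≤-< (≤-trans (≤-reflexive (+-identityʳ a)) (<⇒≤ a<m₁))
                                            (lift<2m₁ e₂ b<m₁) ⟩
      3 * m₁                  ≤⟨ 3m₁≤2m₂ ⟩
      2 * m₂                  ∎)) (m+n≮m 2 k)
    where open ≤-Reasoning
  shift∈shifts {a} {b} {t} {0} (suc zero) e₂ _ _ sum≡ =
    there (there (there (here (cong (suc zero ,_) (sym (extraWrap≡0 m₁≤t))))))
    where
    open ≤-Reasoning
    m₁≤t : m₁ ≤ t
    m₁≤t = begin
      m₁                            ≤⟨ ≤-trans (m≤m+n m₁ 0) (m≤n+m (m₁ + 0) a) ⟩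
      lift a (suc zero)             ≤⟨ m≤m+n _ _ ⟩
      lift a (suc zero) + lift b e₂ ≡⟨ sum≡ ⟩
      t + 0                         ≡⟨ +-identityʳ t ⟩
      t                             ∎
  shift∈shifts {k = 1} (suc zero) _ _ _ _ = there (there (here refl))
  shift∈shifts {a} {b} {t} {2} (suc zero) e₂ a<m₁ b<m₁ sum≡ =
    there (there (there (here (cong (suc zero ,_) (sym (extraWrap≡2 (begin-strict
      t + 2 * m₂                    ≡⟨ sum≡ ⟨
      lift a (suc zero) + lift b e₂ <⟨ lift-sum<4m₁ (suc zero) e₂ a<m₁ b<m₁ ⟩
      4 * m₁                        ∎)))))))
    where open ≤-Reasoning
  shift∈shifts {a} {b} {t} {suc (suc (suc k))} (suc zero) e₂ a<m₁ b<m₁ sum≡ =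
    contradiction (wraps< {t} (begin-strict
      t + (3 + k) * m₂              ≡⟨ sum≡ ⟨
      lift a (suc zero) + lift b e₂ <⟨ lift-sum<4m₁ (suc zero) e₂ a<m₁ b<m₁ ⟩
      4 * m₁                        ≤⟨ 4m₁≤3m₂ ⟩
      3 * m₂                        ∎)) (m+n≮m 3 k)
    where open ≤-Reasoning

  representative : ∀ {t} → t < m₂ → ∃[ s ] m₁ ≤ s × s < 3 * m₁ × s % m₂ ≡ t
  representative {t} t<m₂ with t <? m₁
  ... | yes t<m₁ = t + m₂ , ≤-trans m₁≤m₂ (m≤n+m m₂ t) , +-mono-< t<m₁ m₂<2m₁ ,
                   trans ([m+n]%n≡m%n t m₂) (m<n⇒m%n≡m t<m₂)
  ... | no t≮m₁  = t , ≮⇒≥ t≮m₁ , <-≤-trans (<-trans t<m₂ m₂<2m₁) (m≤n+m (2 * m₁) m₁) ,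
                   m<n⇒m%n≡m t<m₂

  lift-decomposition : ∀ {u s} → u < 2 * m₁ → m₁ ≤ s → s < 3 * m₁ → u % m₁ ≡ s % m₁ →
                       Σ[ e₁ ∈ Fin 2 ] Σ[ e₂ ∈ Fin 2 ] u + (toℕ e₁ + toℕ e₂) * m₁ ≡ s
  lift-decomposition {u} {s} u<2m₁ m₁≤s s<3m₁ u≡s with sum-of-two-bits c≤2
    where
    c≤2 : s / m₁ ∸ u / m₁ ≤ 2
    c≤2 = ≤-trans (m∸n≤m (s / m₁) (u / m₁)) (≤-pred (m<n*o⇒m/o<n s<3m₁))
  ... | e₁ , e₂ , e₁+e₂≡c = e₁ , e₂ , (begin
    u + (toℕ e₁ + toℕ e₂) * m₁ ≡⟨ cong (λ c → u + c * m₁) e₁+e₂≡c ⟩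
    u + (s / m₁ ∸ u / m₁) * m₁ ≡⟨ [u%m≡s%m]⇒s≡u+[s/m∸u/m]*m u≡s u/m₁≤s/m₁ ⟨
    s                          ∎)
    where
    open ≡-Reasoning
    u/m₁≤s/m₁ : u / m₁ ≤ s / m₁
    u/m₁≤s/m₁ = ≤-trans (≤-pred (m<n*o⇒m/o<n u<2m₁)) (m≥n⇒m/n>0 m₁≤s)

  module _ (A : Subset m₁) where

    Lifted : Fin m₂ → Set
    Lifted x = ∃[ a ] ∃[ e ] a ∈ₛ A × lift (toℕ a) e % m₂ ≡ toℕ x

    lifted? : ∀ x → Dec (Lifted x)
    lifted? x = any? λ a → any? λ e → (a ∈? A) ×-dec (lift (toℕ a) e % m₂ ≟ toℕ x)

    lifted : Subset m₂
    lifted = tabulate (does ∘ lifted?)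

    ∈-lifted⁺ : ∀ {x} → Lifted x → x ∈ₛ lifted
    ∈-lifted⁺ {x} w =
      lookup⇒[]= x lifted (trans (lookup∘tabulate (does ∘ lifted?) x) (dec-true (lifted? x) w))

    ∈-lifted⁻ : ∀ {x} → x ∈ₛ lifted → Lifted x
    ∈-lifted⁻ {x} x∈
      with lifted? x | trans (sym (lookup∘tabulate (does ∘ lifted?) x)) ([]=⇒lookup x∈)
    ... | yes w | _ = w
    ... | no _  | ()

    lifted-covers : (∀ j → 1 ≤ σ m₁ A j) → ∀ n → 1 ≤ σ m₂ lifted n
    lifted-covers A-covers n with representative (toℕ<n n)
    ... | s , m₁≤s , s<3m₁ , s≡n with member-of-nonempty (pairs A (s mod m₁)) (A-covers (s mod m₁))
    ... | (a , b) , ab∈ with ∈-pairs⁻ A (s mod m₁) ab∈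
    ... | (a∈A , b∈A) , a+b≡s with lift-decomposition a+b<2m₁ m₁≤s s<3m₁ (trans a+b≡s (toℕ-fromℕ< _))
      where
      a+b<2m₁ : toℕ a + toℕ b < 2 * m₁
      a+b<2m₁ = <-≤-trans (+-mono-< (toℕ<n a) (toℕ<n b))
                          (≤-reflexive (cong (m₁ +_) (sym (+-identityʳ m₁))))
    ... | e₁ , e₂ , decomposition = ∈-length (∈-pairs⁺ lifted n
          (∈-lifted⁺ (a , e₁ , a∈A , sym (toℕ-fromℕ< _)))
          (∈-lifted⁺ (b , e₂ , b∈A , sym (toℕ-fromℕ< _)))
          (SumIs-mod (trans (cong (_% m₂) (trans (lift-sum≡ (toℕ a) (toℕ b) e₁ e₂) decomposition))
                            s≡n)))

    Encodes : ℕ → Fin m₂ × Fin m₂ → (Fin 2 × ℕ) × (Fin m₁ × Fin m₁) → Set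
    Encodes t (x , y) ((e₁ , k) , (a , b)) = ∃[ e₂ ]
      lift (toℕ a) e₁ % m₂ ≡ toℕ x × lift (toℕ b) e₂ % m₂ ≡ toℕ y ×
      lift (toℕ a) e₁ + lift (toℕ b) e₂ ≡ t + k * m₂

    Encodes-injective : ∀ {t p p′ c} → Encodes t p c → Encodes t p′ c → p ≡ p′
    Encodes-injective {c = (e₁ , _) , (a , b)} (e₂ , x≡ , y≡ , sum≡) (e₂′ , x′≡ , y′≡ , sum′≡) =
      cong₂ _,_ (toℕ-injective (trans (sym x≡) x′≡))
                (toℕ-injective (trans (sym y≡) (trans (cong (_% m₂) same-lift) y′≡)))
      where
      same-lift : lift (toℕ b) e₂ ≡ lift (toℕ b) e₂′
      same-lift = +-cancelˡ-≡ (lift (toℕ a) e₁) _ _ (trans sum≡ (sym sum′≡))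

    codes-with : ℕ → Fin 2 × ℕ → List ((Fin 2 × ℕ) × (Fin m₁ × Fin m₁))
    codes-with t sh = map (sh ,_) (pairs A ((t + proj₂ sh * m₂) mod m₁))

    codes : ℕ → List ((Fin 2 × ℕ) × (Fin m₁ × Fin m₁))
    codes t = concatMap (codes-with t) (shifts t)

    length-codes≤ : ∀ {r} → (∀ j → σ m₁ A j ≤ r) → ∀ t → length (codes t) ≤ 4 * r
    length-codes≤ A-bounded t = length-concatMap≤ (codes-with t) bounded (shifts t)
      where
      bounded : ∀ sh → length (codes-with t sh) ≤ _
      bounded sh = ≤-trans (≤-reflexive (length-map (sh ,_) (pairs A _))) (A-bounded _)

    encode : ∀ {n p} → p ∈ pairs lifted n → ∃[ c ] c ∈ codes (toℕ n) × Encodes (toℕ n) p c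
    encode {n} {x , y} p∈ with ∈-pairs⁻ lifted n p∈
    ... | (x∈ , y∈) , x+y≡n with ∈-lifted⁻ x∈ | ∈-lifted⁻ y∈
    ... | a , e₁ , a∈A , x≡ | b , e₂ , b∈A , y≡ = code , code∈codes , (e₂ , x≡ , y≡ , sum≡)
      where
      k = (lift (toℕ a) e₁ + lift (toℕ b) e₂) / m₂
      code = (e₁ , k) , (a , b)
      sum≡ : lift (toℕ a) e₁ + lift (toℕ b) e₂ ≡ toℕ n + k * m₂
      sum≡ = u+v≡t+[u+v]/m*m x≡ y≡ x+y≡n
      residue : (toℕ a + toℕ b) % m₁ ≡ toℕ ((toℕ n + k * m₂) mod m₁)
      residue = trans (lift-sum%m₁ (toℕ a) (toℕ b) e₁ e₂)
                      (trans (cong (_% m₁) sum≡) (sym (toℕ-fromℕ< _)))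
      code∈codes : code ∈ codes (toℕ n)
      code∈codes = ∈-concatMap⁺ (codes-with (toℕ n))
        (lose (shift∈shifts e₁ e₂ (toℕ<n a) (toℕ<n b) sum≡)
              (∈-map⁺ ((e₁ , k) ,_) (∈-pairs⁺ A _ a∈A b∈A residue)))

    lifted-bounded : ∀ {r} → (∀ j → σ m₁ A j ≤ r) → ∀ n → σ m₂ lifted n ≤ 4 * r
    lifted-bounded A-bounded n = ≤-trans
      (injective-encoding⇒length≤ (codes (toℕ n)) (pairs-unique lifted n) encode
        (λ {p} {p′} {c} → Encodes-injective {p = p} {p′} {c}))
      (length-codes≤ A-bounded (toℕ n))

    lifted-admissible : ∀ {r} → Admissible m₁ A r → Admissible m₂ lifted (4 * r)
    lifted-admissible A-admissible n =
      lifted-covers (proj₁ ∘ A-admissible) n , lifted-bounded (proj₂ ∘ A-admissible) n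

lemma4 : (m₁ m₂ : ℕ) .{{_ : NonZero m₁}} .{{_ : NonZero m₂}} →
         3 * m₁ ≤ 2 * m₂ → m₂ < 2 * m₁ →
         (r₁ r₂ : ℕ) → IsRuzsaNumber m₁ r₁ → IsRuzsaNumber m₂ r₂ →
         r₂ ≤ 4 * r₁
lemma4 m₁ m₂ 3m₁≤2m₂ m₂<2m₁ r₁ r₂ (1≤r₁ , (A , A-admissible) , _) (_ , _ , r₂-least) =
  r₂-least (4 * r₁) (≤-trans 1≤r₁ (m≤m+n r₁ _)) (lifted A , lifted-admissible A A-admissible)
  where open Doubling m₁ m₂ 3m₁≤2m₂ m₂<2m₁
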